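{- Let $T$ be a Lyndon word with Lyndon SLP $\mathcal{G}$. For every pattern $P$ of length $m$, the number of partition pairs of $P$ (with respect to $\mathcal{G}$) is $O(\lg m)$.
   Context: A string is a Lyndon word if it is lexicographically strictly smaller than each of its non-empty proper suffixes. The standard factorization of a Lyndon word $w$, $|w|\ge2$, is $(u,v)$ with $w=uv$ and $v$ the longest proper suffix of $w$ that is Lyndon. The Lyndon SLP of a Lyndon word $T$ is the straight-line program (rules $X_i\to a$, $a\in\Sigma$, or $X_i \to X_\ell X_r$ with $\ell,r<i$; $\mathit{val}(X)$ the derived string; start symbol derives $T$) such that every $\mathit{val}(X_i)$ is Lyndon, every rule $X_i\to X_\ell X_r$ satisfies that $(\mathit{val}(X_\ell),\mathit{val}(X_r))$ is the standard factorization of $\mathit{val}(X_i)$, and distinct variables derive distinct strings. A partition pair (at position $i$) of $P[1..m]$ is a pair $(P[1..i],P[i+1..m])$ with $i\in[1..m]$ such that there is a rule $X_j\to X_\ell X_r$ of the Lyndon SLP with $P[1..i]$ a (not necessarily proper) suffix of $\mathit{val}(X_\ell)$ and $P[i+1..m]$ a (not necessarily proper) prefix of $\mathit{val}(X_r)$. -}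

module Defs where

open import Level using (0ℓ)
open import Data.Nat using (ℕ; _<_; _≤_)
open import Data.Fin using (Fin; toℕ)
open import Data.List using (List; []; _∷_; [_]; _++_; length; take; drop)
open import Data.Product using (Σ; ∃; _×_; _,_)
open import Relation.Binary.Core using (Rel)
open import Relation.Binary.PropositionalEquality using (_≡_; _≢_)
open import Data.List.Relation.Binary.Lex.Strict using (Lex-<)

module _ {A : Set} (_≺_ : Rel A 0ℓ) where

  _<lex_ : List A → List A → Set
  u <lex v = Lex-< _≡_ _≺_ u v

  Lyndon : List A → Set
  Lyndon w = (w ≢ []) × (∀ p s → p ≢ [] → s ≢ [] → p ++ s ≡ w → w <lex s)

  StdFact : List A → List A → List A → Set
  StdFact w u v =
    (u ++ v ≡ w) × (u ≢ []) × Lyndon v ×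
    (∀ p s → p ≢ [] → s ≢ [] → p ++ s ≡ w → Lyndon s → length s ≤ length v)

data RHS (A : Set) (n : ℕ) : Set where
  term : A → RHS A n
  bin  : Fin n → Fin n → RHS A n

record SLP (A : Set) (n : ℕ) : Set where
  field
    rule    : Fin n → RHS A n
    ordered : ∀ i l r → rule i ≡ bin l r → (toℕ l < toℕ i) × (toℕ r < toℕ i)
    start   : Fin n

open SLP public

module _ {A : Set} {n : ℕ} (G : SLP A n) where

  -- Derives i w  :  val(X_i) = w   (functional, since the SLP is acyclic)
  data Derives : Fin n → List A → Set where
    dterm : ∀ {i a} → rule G i ≡ term a → Derives i [ a ]
    dbin  : ∀ {i l r u v} → rule G i ≡ bin l r → Derives l u → Derives r v →
            Derives i (u ++ v)

  data Reach : Fin n → Fin n → Set where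
    here  : ∀ {i} → Reach i i
    left  : ∀ {i l r j} → rule G i ≡ bin l r → Reach l j → Reach i j
    right : ∀ {i l r j} → rule G i ≡ bin l r → Reach r j → Reach i j

module _ {A : Set} (_≺_ : Rel A 0ℓ) where

  IsLyndonSLPOf : ∀ {n} → SLP A n → List A → Set
  IsLyndonSLPOf {n} G T =
    Derives G (start G) T ×
    (∀ i → Reach G (start G) i) ×
    (∀ i w → Derives G i w → Lyndon _≺_ w) ×
    (∀ i l r u v → rule G i ≡ bin l r → Derives G l u → Derives G r v →
       StdFact _≺_ (u ++ v) u v) ×
    (∀ i j w → Derives G i w → Derives G j w → i ≡ j)

IsSuffixOf : {A : Set} → List A → List A → Set
IsSuffixOf {A} s w = Σ (List A) λ p → p ++ s ≡ w

IsPrefixOf : {A : Set} → List A → List A → Set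
IsPrefixOf {A} s w = Σ (List A) λ q → s ++ q ≡ w

PartitionPair : {A : Set} {n : ℕ} → SLP A n → List A → ℕ → Set
PartitionPair {A} G P i =
  (1 ≤ i) × (i ≤ length P) ×
  ∃ λ j → ∃ λ l → ∃ λ r → ∃ λ u → ∃ λ v →
    (rule G j ≡ bin l r) × Derives G l u × Derives G r v ×
    IsSuffixOf (take i P) u × IsPrefixOf (drop i P) v

-- Let two partition pairs of P sit at positions a < b and write P = π α σ with |π| = a and
-- |πα| = b.  The pair at b comes from a rule whose standard factorization (u , v) has πα as a
-- suffix of u and σ as a prefix of v; the pair at a gives a Lyndon word x with ασ as a prefix.
-- Maximality of v makes v < αv, and x being Lyndon makes ασ… < σ….  If σ were longer than α,
-- these two comparisons would force σ = ασ′, and then the Lyndon word v = ασ′… would satisfy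
-- αv < v.  Hence |σ| ≤ |α|: from one partition position to the next the distance to the end
-- of P at least halves, so the values ⌊log₂ 2(m − i)⌋ at partition positions i are pairwise
-- distinct and all below 2 + ⌊log₂ m⌋.
module Submission where

open import Defs
open import Level using (0ℓ)
open import Function using (_∘_)
open import Data.Empty using (⊥-elim)
open import Data.Nat using (ℕ; zero; suc; _+_; _*_; _∸_; _≤_; _<_; s≤s; z≤n; s≤s⁻¹; _⊓_; _≟_; >-nonZero)
open import Data.Nat.Properties
open import Data.Nat.Logarithm using (⌊log₂_⌋; ⌊log₂⌋-mono-≤; ⌊log₂[2*b]⌋≡1+⌊log₂b⌋)
open import Data.List using (List; []; _∷_; [_]; _++_; length; take; drop; map; filter)
open import Data.List.Properties
  using ( ∷-injective; ∷-injectiveʳ; ++-assoc; ++-identityʳ; ++-conicalˡ; ++-conicalʳ; take-[]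
        ; take++drop≡id; length-++; length-map; length-take; length-drop
        ; filter-all; filter-accept; filter-reject)
open import Data.List.Relation.Unary.All as All using (All; []; _∷_)
import Data.List.Relation.Unary.All.Properties as All
open import Data.List.Relation.Unary.AllPairs using ([]; _∷_)
open import Data.List.Relation.Unary.Unique.Propositional using (Unique)
import Data.List.Relation.Unary.Unique.Propositional.Properties as Unique
open import Data.List.Relation.Binary.Lex.Strict
  using (this; next) renaming (<-isStrictTotalOrder to lex-isStrictTotalOrder)
open import Data.List.Relation.Binary.Pointwise using (Pointwise-length)
open import Data.Product using (Σ; ∃; _×_; _,_; proj₁; proj₂)
open import Data.Sum using (_⊎_; inj₁; inj₂)
open import Relation.Nullary using (¬_; yes; no; ¬?)
open import Relation.Binary.Core using (Rel)
open import Relation.Binary.Definitions using (tri<; tri≈; tri>)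
open import Relation.Binary.PropositionalEquality using (_≡_; _≢_; refl; sym; trans; cong)
open import Relation.Binary.Structures using (IsStrictTotalOrder)

module _ {A : Set} where

  ++-≡-++ : ∀ (p s y v : List A) → p ++ s ≡ y ++ v →
            (∃ λ t → p ≡ y ++ t × t ++ s ≡ v) ⊎ (∃ λ t → y ≡ p ++ t × s ≡ t ++ v)
  ++-≡-++ p       s []      v e = inj₁ (p , refl , e)
  ++-≡-++ []      s (b ∷ y) v e = inj₂ (b ∷ y , refl , e)
  ++-≡-++ (a ∷ p) s (b ∷ y) v e with ∷-injective e
  ... | refl , e′ with ++-≡-++ p s y v e′
  ...   | inj₁ (t , refl , t++s≡v) = inj₁ (t , refl , t++s≡v)
  ...   | inj₂ (t , refl , s≡t++v) = inj₂ (t , refl , s≡t++v)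

  take-≢[] : ∀ k (xs : List A) → 0 < k → 0 < length xs → take k xs ≢ []
  take-≢[] (suc k) (x ∷ xs) _ _ ()

  length-<⇒≢[] : ∀ {xs ys : List A} → length xs < length ys → ys ≢ []
  length-<⇒≢[] xs<ys refl = n≮0 xs<ys

  take-≤-++ : ∀ {a b} (xs : List A) → a ≤ b → take b xs ≡ take a xs ++ take (b ∸ a) (drop a xs)
  take-≤-++ xs       z≤n       = refl
  take-≤-++ []       (s≤s a≤b) = sym (take-[] _)
  take-≤-++ (x ∷ xs) (s≤s a≤b) = cong (x ∷_) (take-≤-++ xs a≤b)

  drop-≤-++ : ∀ {a b} (xs : List A) → a ≤ b → drop a xs ≡ take (b ∸ a) (drop a xs) ++ drop b xs
  drop-≤-++ {b = b} xs       z≤n       = sym (take++drop≡id b xs)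
  drop-≤-++ {suc a} {suc b} []  _         = sym (cong (_++ []) (take-[] (b ∸ a)))
  drop-≤-++         (x ∷ xs) (s≤s a≤b) = drop-≤-++ xs a≤b

module _ {A : Set} {_≺_ : Rel A 0ℓ} (sto : IsStrictTotalOrder _≡_ _≺_) where
  open IsStrictTotalOrder sto using () renaming (irrefl to ≺-irrefl; asym to ≺-asym)
  open IsStrictTotalOrder (lex-isStrictTotalOrder sto)
    using (compare) renaming (trans to <lex-trans; asym to <lex-asym)

  private
    infix 4 _⊏_
    _⊏_ : List A → List A → Set
    _⊏_ = _<lex_ _≺_

  ⊏-++ˡ : ∀ α {xs ys} → xs ⊏ ys → α ++ xs ⊏ α ++ ys
  ⊏-++ˡ []      lt = lt
  ⊏-++ˡ (a ∷ α) lt = next refl (⊏-++ˡ α lt)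

  ⊏-between⇒prefix : ∀ α s {xs ys xs′ ys′} → length α ≤ length s →
                     s ++ xs ⊏ α ++ ys → α ++ xs′ ⊏ s ++ ys′ → ∃ λ s′ → s ≡ α ++ s′
  ⊏-between⇒prefix []      s       _          _             _             = s , refl
  ⊏-between⇒prefix (a ∷ α) (b ∷ s) _          (this b≺a)    (this a≺b)    = ⊥-elim (≺-asym b≺a a≺b)
  ⊏-between⇒prefix (a ∷ α) (b ∷ s) _          (this b≺a)    (next refl _) = ⊥-elim (≺-irrefl refl b≺a)
  ⊏-between⇒prefix (a ∷ α) (b ∷ s) _          (next refl _) (this a≺b)    = ⊥-elim (≺-irrefl refl a≺b)
  ⊏-between⇒prefix (a ∷ α) (b ∷ s) (s≤s α≤s) (next refl lt) (next refl gt) =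
    let s′ , s≡α++s′ = ⊏-between⇒prefix α s α≤s lt gt in s′ , cong (a ∷_) s≡α++s′

  lyndon-prepend : ∀ {y v} → Lyndon _≺_ v → y ++ v ⊏ v →
                   (∀ p t → p ≢ [] → t ≢ [] → p ++ t ≡ y → v ⊏ t ++ v) →
                   Lyndon _≺_ (y ++ v)
  lyndon-prepend {y} {v} (v≢[] , v-min) yv⊏v below = v≢[] ∘ ++-conicalʳ y v , yv-min
    where
    yv-min : ∀ p s → p ≢ [] → s ≢ [] → p ++ s ≡ y ++ v → y ++ v ⊏ s
    yv-min p s p≢[] s≢[] e with ++-≡-++ p s y v e
    ... | inj₁ ([]        , _ , refl)   = yv⊏v
    ... | inj₁ (t@(_ ∷ _) , _ , t++s≡v) = <lex-trans yv⊏v (v-min t s (λ ()) s≢[] t++s≡v)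
    ... | inj₂ ([]        , _ , refl)   = yv⊏v
    ... | inj₂ (t@(_ ∷ _) , y≡p++t , refl) =
      <lex-trans yv⊏v (below p t p≢[] (λ ()) (sym y≡p++t))

  lyndon-prepend-prefix : ∀ {α v′ v} → Lyndon _≺_ v → α ≢ [] → v′ ≢ [] → α ++ v′ ≡ v →
                          α ++ v ⊏ v
  lyndon-prepend-prefix {α} {v′} (_ , v-min) α≢[] v′≢[] refl =
    ⊏-++ˡ α (v-min α v′ α≢[] v′≢[] refl)

  stdFact-right-below : ∀ {w u v} → StdFact _≺_ w u v → ∀ q y → q ≢ [] → q ++ y ≡ u →
                        ∀ p t → t ≢ [] → p ++ t ≡ y → v ⊏ t ++ v
  stdFact-right-below sf q [] _ _ p t t≢[] p++t≡[] = ⊥-elim (t≢[] (++-conicalʳ p t p++t≡[]))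
  stdFact-right-below {w} {u} {v} sf@(u++v≡w , _ , v-lyn , v-longest) q (c ∷ y) q≢[] q++y≡u =
    below
    where
    below-tail : ∀ p t → t ≢ [] → p ++ t ≡ y → v ⊏ t ++ v
    below-tail = stdFact-right-below sf (q ++ [ c ]) y (q≢[] ∘ ++-conicalˡ q [ c ])
                   (trans (++-assoc q [ c ] y) q++y≡u)

    below-proper : ∀ p t → p ≢ [] → t ≢ [] → p ++ t ≡ c ∷ y → v ⊏ t ++ v
    below-proper []      _ p≢[] _    _ = ⊥-elim (p≢[] refl)
    below-proper (_ ∷ p) t _    t≢[] e = below-tail p t t≢[] (∷-injectiveʳ e)

    v<cyv : length v < length (c ∷ y ++ v)
    v<cyv = s≤s (≤-trans (m≤n+m (length v) (length y)) (≤-reflexive (sym (length-++ y))))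

    q++cyv≡w : q ++ c ∷ y ++ v ≡ w
    q++cyv≡w = trans (sym (++-assoc q (c ∷ y) v)) (trans (cong (_++ v) q++y≡u) u++v≡w)

    -- if c y v were smaller than v it would be a Lyndon suffix of w longer than v
    v⊏cyv : v ⊏ c ∷ y ++ v
    v⊏cyv with compare (c ∷ y ++ v) v
    ... | tri> _ _ v⊏cyv = v⊏cyv
    ... | tri≈ _ cyv≋v _ = ⊥-elim (<-irrefl (sym (Pointwise-length cyv≋v)) v<cyv)
    ... | tri< cyv⊏v _ _ = ⊥-elim (<⇒≱ v<cyv
            (v-longest q (c ∷ y ++ v) q≢[] (λ ()) q++cyv≡w (lyndon-prepend v-lyn cyv⊏v below-proper)))

    below : ∀ p t → t ≢ [] → p ++ t ≡ c ∷ y → v ⊏ t ++ v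
    below []      _ _    refl = v⊏cyv
    below (_ ∷ p) t t≢[] e    = below-tail p t t≢[] (∷-injectiveʳ e)

  stdFact-overlap : ∀ {w u v x} → StdFact _≺_ w u v → Lyndon _≺_ x →
                    ∀ ρ π α σ ζ ξ → π ≢ [] → α ≢ [] →
                    ρ ++ π ++ α ≡ u → σ ++ ζ ≡ v → α ++ σ ++ ξ ≡ x → length σ ≤ length α
  stdFact-overlap sf@(_ , _ , v-lyn , _) (_ , x-min) ρ π α σ ζ ξ π≢[] α≢[] refl refl refl =
    ≮⇒≥ σ-not-longer
    where
    v⊏αv : σ ++ ζ ⊏ α ++ σ ++ ζ
    v⊏αv = stdFact-right-below sf (ρ ++ π) α (π≢[] ∘ ++-conicalʳ ρ π) (++-assoc ρ π α)
             [] α α≢[] refl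

    αx⊏x : length α < length σ → α ++ σ ++ ξ ⊏ σ ++ ξ
    αx⊏x α<σ = x-min α (σ ++ ξ) α≢[] (length-<⇒≢[] {xs = α} α<σ ∘ ++-conicalˡ σ ξ) refl

    σ-not-longer : ¬ length α < length σ
    σ-not-longer α<σ with ⊏-between⇒prefix α σ (<⇒≤ α<σ) v⊏αv (αx⊏x α<σ)
    ... | [] , σ≡α++[] =
      <-irrefl (sym (trans (cong length σ≡α++[]) (cong length (++-identityʳ α)))) α<σ
    ... | σ′@(_ ∷ _) , σ≡α++σ′ =
      <lex-asym v⊏αv (lyndon-prepend-prefix v-lyn α≢[] (λ ()) α++σ′++ζ≡v)
      where
      α++σ′++ζ≡v : α ++ σ′ ++ ζ ≡ σ ++ ζ
      α++σ′++ζ≡v = trans (sym (++-assoc α σ′ ζ)) (cong (_++ ζ) (sym σ≡α++σ′))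

module _ {A B : Set} {P : A → Set} (f : A → B)
         (f-injective : ∀ {x y} → P x → P y → f x ≡ f y → x ≡ y) where

  Unique-map⁺-on : ∀ {xs} → All P xs → Unique xs → Unique (map f xs)
  Unique-map⁺-on []         []         = []
  Unique-map⁺-on (px ∷ pxs) (x∉xs ∷ u) =
    All.map⁺ (All.zipWith (λ (py , x≢y) → x≢y ∘ f-injective px py) (pxs , x∉xs))
      ∷ Unique-map⁺-on pxs u

length≤1+length-filter≢ : ∀ k {xs} → Unique xs → length xs ≤ suc (length (filter (¬? ∘ (_≟ k)) xs))
length≤1+length-filter≢ k {[]}     []         = z≤n
length≤1+length-filter≢ k {x ∷ xs} (x∉xs ∷ u) with x ≟ k
... | yes refl = s≤s (≤-reflexive (sym (cong length (trans
                   (filter-reject (¬? ∘ (_≟ k)) (λ k≢k → k≢k refl))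
                   (filter-all (¬? ∘ (_≟ k)) (All.map (_∘ sym) x∉xs))))))
... | no x≢k   = s≤s (≤-trans (length≤1+length-filter≢ k u)
                   (≤-reflexive (cong length (sym (filter-accept (¬? ∘ (_≟ k)) x≢k)))))

Unique-length≤ : ∀ n {xs} → Unique xs → All (_< n) xs → length xs ≤ n
Unique-length≤ zero    {[]}    _ _        = z≤n
Unique-length≤ zero    {_ ∷ _} _ (() ∷ _)
Unique-length≤ (suc n) {xs}    u xs<1+n   = begin
  length xs                                ≤⟨ length≤1+length-filter≢ n u ⟩
  suc (length (filter (¬? ∘ (_≟ n)) xs))  ≤⟨ s≤s (Unique-length≤ n (Unique.filter⁺ _ u) xs≢n<n) ⟩
  suc n                                    ∎
  where
  open ≤-Reasoning
  xs≢n<n : All (_< n) (filter (¬? ∘ (_≟ n)) xs)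
  xs≢n<n = All.zipWith (λ (x<1+n , x≢n) → ≤∧≢⇒< (s≤s⁻¹ x<1+n) x≢n)
                       (All.filter⁺ _ xs<1+n , All.all-filter _ xs)

⌊log₂[2m]⌋<⌊log₂[2n]⌋ : ∀ {m n} → 0 < n → 2 * m ≤ n → ⌊log₂ (2 * m) ⌋ < ⌊log₂ (2 * n) ⌋
⌊log₂[2m]⌋<⌊log₂[2n]⌋ {zero}      {n} 0<n _ =
  ≤-trans (s≤s z≤n) (≤-reflexive (sym (⌊log₂[2*b]⌋≡1+⌊log₂b⌋ n {{>-nonZero 0<n}})))
⌊log₂[2m]⌋<⌊log₂[2n]⌋ {m@(suc _)} {n} _ 2m≤n = begin-strict
  ⌊log₂ (2 * m) ⌋          <⟨ n<1+n _ ⟩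
  1 + ⌊log₂ (2 * m) ⌋      ≡⟨ ⌊log₂[2*b]⌋≡1+⌊log₂b⌋ (2 * m) ⟨
  ⌊log₂ (2 * (2 * m)) ⌋    ≤⟨ ⌊log₂⌋-mono-≤ (*-monoʳ-≤ 2 2m≤n) ⟩
  ⌊log₂ (2 * n) ⌋          ∎
  where open ≤-Reasoning

⌊log₂[2n]⌋≤1+⌊log₂n⌋ : ∀ n → ⌊log₂ (2 * n) ⌋ ≤ 1 + ⌊log₂ n ⌋
⌊log₂[2n]⌋≤1+⌊log₂n⌋ zero        = z≤n
⌊log₂[2n]⌋≤1+⌊log₂n⌋ n@(suc _)   = ≤-reflexive (⌊log₂[2*b]⌋≡1+⌊log₂b⌋ n)

module _ {A : Set} {_≺_ : Rel A 0ℓ} (sto : IsStrictTotalOrder _≡_ _≺_)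
         {n} {G : SLP A n} {T : List A} (G-lyndon : IsLyndonSLPOf _≺_ G T) (P : List A) where

  private
    m = length P

    derives-lyndon : ∀ i w → Derives G i w → Lyndon _≺_ w
    derives-lyndon = proj₁ (proj₂ (proj₂ G-lyndon))

    rule-stdFact : ∀ i l r u v → rule G i ≡ bin l r → Derives G l u → Derives G r v →
                   StdFact _≺_ (u ++ v) u v
    rule-stdFact = proj₁ (proj₂ (proj₂ (proj₂ G-lyndon)))

  partitionPair-gap : ∀ {a b} → a < b → PartitionPair G P a → PartitionPair G P b → m ∸ b ≤ b ∸ a
  partitionPair-gap {a} {b} a<b
    (1≤a , _ , _ , _ , r , _ , x , _ , _ , r⇒x , _ , (ξ , drop-a++ξ≡x))
    (_ , b≤m , j , l , r′ , u , v , j⇒lr′ , l⇒u , r′⇒v , (ρ , ρ++take-b≡u) , (ζ , drop-b++ζ≡v)) =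
    begin
      m ∸ b                        ≡⟨ length-drop b P ⟨
      length σ                     ≤⟨ stdFact-overlap sto (rule-stdFact j l r′ u v j⇒lr′ l⇒u r′⇒v)
                                        (derives-lyndon r x r⇒x) ρ π α σ ζ ξ π≢[] α≢[]
                                        ρ++π++α≡u drop-b++ζ≡v α++σ++ξ≡x ⟩
      length α                     ≡⟨ length-take (b ∸ a) (drop a P) ⟩
      (b ∸ a) ⊓ length (drop a P)  ≤⟨ m⊓n≤m _ _ ⟩
      b ∸ a                        ∎
    where
    open ≤-Reasoning
    a<m : a < m
    a<m = <-≤-trans a<b b≤m

    π = take a P
    α = take (b ∸ a) (drop a P)
    σ = drop b P

    π≢[] : π ≢ []
    π≢[] = take-≢[] a P 1≤a (≤-<-trans z≤n a<m)

    α≢[] : α ≢ []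
    α≢[] = take-≢[] (b ∸ a) (drop a P) (m<n⇒0<n∸m a<b)
             (≤-trans (m<n⇒0<n∸m a<m) (≤-reflexive (sym (length-drop a P))))

    ρ++π++α≡u : ρ ++ π ++ α ≡ u
    ρ++π++α≡u = trans (cong (ρ ++_) (sym (take-≤-++ P (<⇒≤ a<b)))) ρ++take-b≡u

    α++σ++ξ≡x : α ++ σ ++ ξ ≡ x
    α++σ++ξ≡x = trans (sym (++-assoc α σ ξ))
                  (trans (cong (_++ ξ) (sym (drop-≤-++ P (<⇒≤ a<b)))) drop-a++ξ≡x)

  rank : ℕ → ℕ
  rank i = ⌊log₂ (2 * (m ∸ i)) ⌋

  rank-decreasing : ∀ {a b} → a < b → PartitionPair G P a → PartitionPair G P b → rank b < rank a
  rank-decreasing {a} {b} a<b ppa ppb@(_ , b≤m , _) =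
    ⌊log₂[2m]⌋<⌊log₂[2n]⌋ {m ∸ b} (m<n⇒0<n∸m (<-≤-trans a<b b≤m)) (begin
      2 * (m ∸ b)          ≡⟨ cong ((m ∸ b) +_) (+-identityʳ (m ∸ b)) ⟩
      (m ∸ b) + (m ∸ b)    ≤⟨ +-monoʳ-≤ (m ∸ b) (partitionPair-gap a<b ppa ppb) ⟩
      (m ∸ b) + (b ∸ a)    ≡⟨ +-∸-assoc (m ∸ b) (<⇒≤ a<b) ⟨
      (m ∸ b) + b ∸ a      ≡⟨ cong (_∸ a) (m∸n+n≡m b≤m) ⟩
      m ∸ a                ∎)
    where open ≤-Reasoning

  rank-injective : ∀ {a b} → PartitionPair G P a → PartitionPair G P b → rank a ≡ rank b → a ≡ b
  rank-injective {a} {b} ppa ppb ra≡rb with <-cmp a b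
  ... | tri< a<b _ _ = ⊥-elim (<-irrefl (sym ra≡rb) (rank-decreasing a<b ppa ppb))
  ... | tri≈ _ a≡b _ = a≡b
  ... | tri> _ _ b<a = ⊥-elim (<-irrefl ra≡rb (rank-decreasing b<a ppb ppa))

  rank<2+⌊log₂m⌋ : ∀ i → rank i < 2 + ⌊log₂ m ⌋
  rank<2+⌊log₂m⌋ i = s≤s (≤-trans (⌊log₂⌋-mono-≤ (*-monoʳ-≤ 2 (m∸n≤m m i))) (⌊log₂[2n]⌋≤1+⌊log₂n⌋ m))

  partitionPairs-length≤ : ∀ {is} → Unique is → All (PartitionPair G P) is →
                           length is ≤ 2 + ⌊log₂ m ⌋
  partitionPairs-length≤ {is} unique pps = begin
    length is             ≡⟨ length-map rank is ⟨
    length (map rank is)  ≤⟨ Unique-length≤ _ (Unique-map⁺-on rank rank-injective pps unique)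
                                               (All.map⁺ (All.universal rank<2+⌊log₂m⌋ is)) ⟩
    2 + ⌊log₂ m ⌋         ∎
    where open ≤-Reasoning

theorem1 : Σ ℕ λ c →
    ∀ {A : Set} (_≺_ : Rel A 0ℓ) → IsStrictTotalOrder _≡_ _≺_ →
    ∀ (T : List A) → Lyndon _≺_ T →
    ∀ {n} (G : SLP A n) → IsLyndonSLPOf _≺_ G T →
    ∀ (P : List A) (is : List ℕ) → Unique is → All (PartitionPair G P) is →
    length is ≤ c * (1 + ⌊log₂ length P ⌋)
theorem1 = 2 , λ _ sto _ _ _ G-lyndon P _ unique pps →
  ≤-trans (partitionPairs-length≤ sto G-lyndon P unique pps) (2+n≤2*[1+n] ⌊log₂ length P ⌋)
  where
  2+n≤2*[1+n] : ∀ n → 2 + n ≤ 2 * (1 + n)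
  2+n≤2*[1+n] n = ≤-trans (+-monoʳ-≤ 2 (m≤n*m n 2)) (≤-reflexive (sym (*-distribˡ-+ 2 1 n)))
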